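{- Let $\mathbb{A}=[a_{ij}]$ be a $k\times k$ matrix with nonnegative entries, let $r_i=\sum_j a_{ij}$ and $c_j=\sum_i a_{ij}$ be its row and column sums, and let $\theta$ be an integer with $1\le\theta\le k-1$. Then $$\sum_{i,j\in[k],\ i+\theta\le j} r_i c_j\ \ge\ \frac{k-\theta+1}{2(k-\theta)}\left(\sum_{i,j\in[k],\ i+\theta\le j}a_{ij}\right)^2.$$
   Formalization: The entries $a_{ij}$ are nonnegative rationals. -}

module Defs where

open import Data.Nat using (ℕ; zero; suc; _+_; _*_; _∸_; _≤ᵇ_)
open import Data.Fin using (Fin; toℕ) renaming (zero to fz; suc to fs)
open import Data.Bool using (if_then_else_)
open import Data.Integer using (+_)
open import Data.Rational using (ℚ; 0ℚ; _/_) renaming (_+_ to _+ℚ_)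

Σ : (n : ℕ) → (Fin n → ℚ) → ℚ
Σ zero    f = 0ℚ
Σ (suc n) f = f fz +ℚ Σ n (λ i → f (fs i))

Matrix : ℕ → Set
Matrix k = Fin k → Fin k → ℚ

rowSum : {k : ℕ} → Matrix k → Fin k → ℚ
rowSum {k} a i = Σ k (λ j → a i j)

colSum : {k : ℕ} → Matrix k → Fin k → ℚ
colSum {k} a j = Σ k (λ i → a i j)

ΣAbove : (k θ : ℕ) → (Fin k → Fin k → ℚ) → ℚ
ΣAbove k θ f = Σ k (λ i → Σ k (λ j → if toℕ i + θ ≤ᵇ toℕ j then f i j else 0ℚ))

-- the coefficient (k-θ+1) / (2(k-θ)); only used when k - θ ≥ 1
coef : ℕ → ℕ → ℚ
coef k θ with k ∸ θ
... | zero  = 0ℚ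
... | suc m = (+ (suc m + 1)) / (2 * suc m)

-- Let u i be the part of row i lying on or above the θ-th superdiagonal, so that the
-- left-hand sum is S = Σ u i, and u vanishes beyond the first m = k − θ indices.
-- The quadratic form F u = Σ_{i ≤ i'} u i u i' equals (S² + Σ u i²)/2, which by
-- Cauchy–Schwarz on m terms is at least (m + 1)/(2m) S²; an induction on the length
-- of u gives this bound directly, each step being a completed square. On the other
-- hand u i ≤ r i, and the tail sum Σ_{i' ≥ i} u i' only involves entries a i' j with
-- j ≥ i + θ, hence is at most Σ_{j ≥ i + θ} c j; multiplying gives
-- F u ≤ Σ_{i + θ ≤ j} r i c j.
module Submission where

open import Defs
open import Data.Nat using (ℕ; _≤_; _∸_)
open import Data.Fin using (Fin)
open import Data.Rational using (ℚ; 0ℚ; _*_) renaming (_≤_ to _≤ℚ_)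

open import Algebra.Bundles using (CommutativeRing)
open import Data.Bool using (Bool; true; false; if_then_else_; T)
open import Data.Empty using (⊥-elim)
open import Data.Fin using (toℕ) renaming (zero to fz; suc to fs)
open import Data.Fin.Properties using (toℕ<n)
open import Data.Integer using (+_)
open import Data.Nat using (zero; suc; _≤ᵇ_; s≤s; z≤n)
import Data.Nat as ℕ
import Data.Nat.Properties as ℕ
open import Data.Rational using (1ℚ; _+_; _-_; -_; _/_; toℚᵘ; Positive; nonNegative; nonPositive; positive)
open import Data.Rational.Properties
open import Data.Rational.Unnormalised as ℚᵘ using (mkℚᵘ; *≡*) renaming (_≃_ to _≃ᵘ_)
import Data.Rational.Unnormalised.Properties as ℚᵘ
open import Data.Sum using (inj₁; inj₂)
open import Data.Unit using (tt)
open import Function using (_∘_)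
open import Relation.Binary.PropositionalEquality
open import Relation.Nullary using (¬_)
import Data.Integer as ℤ using (_+_; _*_)
import Data.Integer.Properties as ℤ
import Data.Rational.Solver as Solver

open import Algebra.Properties.Semiring.Sum (CommutativeRing.semiring +-*-commutativeRing)
  using (sum; sum-cong-≗; sum-replicate-zero; ∑-comm; *-distribˡ-sum)
open import Algebra.Properties.Semiring.Mult (CommutativeRing.semiring +-*-commutativeRing)
  using (_×_; ×-homo-+)

-- Unlike (+ n) / 1, this unfolds to 1ℚ + fromℕ n on successors.
fromℕ : ℕ → ℚ
fromℕ n = n × 1ℚ

toℚᵘ-fromℕ : ∀ n → toℚᵘ (fromℕ n) ≃ᵘ mkℚᵘ (+ n) 0
toℚᵘ-fromℕ zero    = ℚᵘ.≃-refl
toℚᵘ-fromℕ (suc n) = ℚᵘ.≃-trans (toℚᵘ-homo-+ 1ℚ (fromℕ n))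
  (ℚᵘ.≃-trans (ℚᵘ.+-congʳ (toℚᵘ 1ℚ) (toℚᵘ-fromℕ n)) (*≡* (cong (ℤ._* + 1) (1+n≡suc n))))
  where
  1+n≡suc : ∀ n → + 1 ℤ.* + 1 ℤ.+ + n ℤ.* + 1 ≡ + suc n
  1+n≡suc n = cong (λ z → + 1 ℤ.+ z) (ℤ.*-identityʳ (+ n))

fromℕ-nonNeg : ∀ n → 0ℚ ≤ℚ fromℕ n
fromℕ-nonNeg zero    = ≤-refl
fromℕ-nonNeg (suc n) = +-mono-≤ (nonNegative⁻¹ 1ℚ) (fromℕ-nonNeg n)

fromℕ-pos : ∀ n → Positive (fromℕ (suc n))
fromℕ-pos n = positive (+-mono-<-≤ (positive⁻¹ 1ℚ) (fromℕ-nonNeg n))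

n/d*d≡n : ∀ n d → ((+ n) / suc d) * fromℕ (suc d) ≡ fromℕ n
n/d*d≡n n d = toℚᵘ-injective (begin
  toℚᵘ ((+ n / suc d) * fromℕ (suc d))            ≈⟨ toℚᵘ-homo-* (+ n / suc d) (fromℕ (suc d)) ⟩
  toℚᵘ (+ n / suc d) ℚᵘ.* toℚᵘ (fromℕ (suc d))    ≈⟨ ℚᵘ.*-cong (toℚᵘ-fromℚᵘ (mkℚᵘ (+ n) d)) (toℚᵘ-fromℕ (suc d)) ⟩
  mkℚᵘ (+ n) d ℚᵘ.* mkℚᵘ (+ suc d) 0             ≈⟨ *≡* (trans (ℤ.*-identityʳ _) (cong (λ e → + n ℤ.* + suc e) d≡d*1)) ⟩
  mkℚᵘ (+ n) 0                                   ≈⟨ ℚᵘ.≃-sym (toℚᵘ-fromℕ n) ⟩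
  toℚᵘ (fromℕ n)                                 ∎)
  where
  open import Relation.Binary.Reasoning.Setoid ℚᵘ.≃-setoid
  d≡d*1 : d ≡ d ℕ.* 1
  d≡d*1 = sym (ℕ.*-identityʳ d)

p≤q⇒0≤q-p : ∀ {p q} → p ≤ℚ q → 0ℚ ≤ℚ q - p
p≤q⇒0≤q-p {p} {q} p≤q = subst (_≤ℚ q - p) (+-inverseʳ p) (+-monoˡ-≤ (- p) p≤q)

0≤q⇒p≤p+q : ∀ p {q} → 0ℚ ≤ℚ q → p ≤ℚ p + q
0≤q⇒p≤p+q p 0≤q = subst (_≤ℚ p + _) (+-identityʳ p) (+-monoʳ-≤ p 0≤q)

0≤p*q : ∀ {p q} → 0ℚ ≤ℚ p → 0ℚ ≤ℚ q → 0ℚ ≤ℚ p * q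
0≤p*q {p} {q} 0≤p 0≤q =
  nonNegative⁻¹ (p * q) {{nonNeg*nonNeg⇒nonNeg p {{nonNegative 0≤p}} q {{nonNegative 0≤q}}}}

0≤p*p : ∀ p → 0ℚ ≤ℚ p * p
0≤p*p p with ≤-total 0ℚ p
... | inj₁ 0≤p = 0≤p*q 0≤p 0≤p
... | inj₂ p≤0 = nonNegative⁻¹ (p * p) {{nonPos*nonPos⇒nonPos p {{nonPositive p≤0}} p {{nonPositive p≤0}}}}

*-mono-≤-nonNeg : ∀ {p q r s} → 0ℚ ≤ℚ q → 0ℚ ≤ℚ r → p ≤ℚ q → r ≤ℚ s → p * r ≤ℚ q * s
*-mono-≤-nonNeg {q = q} {r = r} 0≤q 0≤r p≤q r≤s = ≤-trans
  (*-monoʳ-≤-nonNeg r {{nonNegative 0≤r}} p≤q) (*-monoˡ-≤-nonNeg q {{nonNegative 0≤q}} r≤s)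

Σ≡sum : ∀ n (f : Fin n → ℚ) → Σ n f ≡ sum f
Σ≡sum zero    f = refl
Σ≡sum (suc n) f = cong (λ s → f fz + s) (Σ≡sum n (f ∘ fs))

Σ-cong : ∀ n {f g : Fin n → ℚ} → (∀ i → f i ≡ g i) → Σ n f ≡ Σ n g
Σ-cong n {f} {g} f≗g = trans (Σ≡sum n f) (trans (sum-cong-≗ f≗g) (sym (Σ≡sum n g)))

Σ-0 : ∀ n {f : Fin n → ℚ} → (∀ i → f i ≡ 0ℚ) → Σ n f ≡ 0ℚ
Σ-0 n f≗0 = trans (Σ-cong n f≗0) (trans (Σ≡sum n _) (sum-replicate-zero n))

*-distribˡ-Σ : ∀ n c (f : Fin n → ℚ) → c * Σ n f ≡ Σ n (λ i → c * f i)
*-distribˡ-Σ n c f = trans (cong (c *_) (Σ≡sum n f)) (trans (*-distribˡ-sum c f) (sym (Σ≡sum n _)))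

Σ-comm : ∀ m n (f : Fin m → Fin n → ℚ) → Σ m (λ i → Σ n (f i)) ≡ Σ n (λ j → Σ m (λ i → f i j))
Σ-comm m n f = trans (Σ²≡sum² m n f) (trans (∑-comm f) (sym (Σ²≡sum² n m (λ j i → f i j))))
  where
  Σ²≡sum² : ∀ m n (f : Fin m → Fin n → ℚ) → Σ m (λ i → Σ n (f i)) ≡ sum (λ i → sum (f i))
  Σ²≡sum² m n f = trans (Σ≡sum m _) (sum-cong-≗ (λ i → Σ≡sum n (f i)))

Σ-mono : ∀ n {f g : Fin n → ℚ} → (∀ i → f i ≤ℚ g i) → Σ n f ≤ℚ Σ n g
Σ-mono zero    f≤g = ≤-refl
Σ-mono (suc n) f≤g = +-mono-≤ (f≤g fz) (Σ-mono n (f≤g ∘ fs))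

Σ-nonNeg : ∀ n {f : Fin n → ℚ} → (∀ i → 0ℚ ≤ℚ f i) → 0ℚ ≤ℚ Σ n f
Σ-nonNeg n {f} 0≤f = subst (_≤ℚ Σ n f) (Σ-0 n {λ _ → 0ℚ} (λ _ → refl)) (Σ-mono n 0≤f)

when : Bool → ℚ → ℚ
when b v = if b then v else 0ℚ

when-nonNeg : ∀ b {v} → 0ℚ ≤ℚ v → 0ℚ ≤ℚ when b v
when-nonNeg true  0≤v = 0≤v
when-nonNeg false 0≤v = ≤-refl

when-≤ : ∀ b {v} → 0ℚ ≤ℚ v → when b v ≤ℚ v
when-≤ true  0≤v = ≤-refl
when-≤ false 0≤v = 0≤v

when-false : ∀ {b} v → ¬ T b → when b v ≡ 0ℚ
when-false {true}  v ¬b = ⊥-elim (¬b tt)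
when-false {false} v ¬b = refl

when-when-≤ : ∀ b c d {v} → (T b → T c → T d) → 0ℚ ≤ℚ v → when b (when c v) ≤ℚ when d v
when-when-≤ true  true  true  b⇒c⇒d 0≤v = ≤-refl
when-when-≤ true  true  false b⇒c⇒d 0≤v = ⊥-elim (b⇒c⇒d tt tt)
when-when-≤ true  false d b⇒c⇒d 0≤v = when-nonNeg d 0≤v
when-when-≤ false c     d b⇒c⇒d 0≤v = when-nonNeg d 0≤v

*-when : ∀ b p q → p * when b q ≡ when b (p * q)
*-when true  p q = refl
*-when false p q = *-zeroʳ p

Σ-when : ∀ n b (f : Fin n → ℚ) → Σ n (λ i → when b (f i)) ≡ when b (Σ n f)
Σ-when n true  f = refl
Σ-when n false f = Σ-0 n (λ _ → refl)

s≤ᵇs : ∀ m n → (suc m ≤ᵇ suc n) ≡ (m ≤ᵇ n)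
s≤ᵇs zero    n = refl
s≤ᵇs (suc m) n = refl

tailSum : ∀ {n} → (Fin n → ℚ) → Fin n → ℚ
tailSum {n} u i = Σ n (λ i′ → when (toℕ i ≤ᵇ toℕ i′) (u i′))

pairSum : ∀ {n} → (Fin n → ℚ) → ℚ
pairSum {n} u = Σ n (λ i → u i * tailSum u i)

tailSum-fs : ∀ {n} (u : Fin (suc n) → ℚ) i → tailSum u (fs i) ≡ tailSum (u ∘ fs) i
tailSum-fs {n} u i = trans (+-identityˡ _)
  (Σ-cong n (λ i′ → cong (λ b → when b (u (fs i′))) (s≤ᵇs (toℕ i) (toℕ i′))))

pairSum-suc : ∀ {n} (u : Fin (suc n) → ℚ) → pairSum u ≡ u fz * Σ (suc n) u + pairSum (u ∘ fs)
pairSum-suc {n} u = cong (λ F → u fz * Σ (suc n) u + F) (Σ-cong n (λ i → cong (u (fs i) *_) (tailSum-fs u i)))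

-- q · (right − left) = (1 + q) · (slack of the hypothesis) + (q x − U)²
pairSum-bound-step : ∀ q x U F → Positive q → (1ℚ + q) * (U * U) ≤ℚ (q + q) * F →
  (1ℚ + (1ℚ + q)) * ((x + U) * (x + U)) ≤ℚ ((1ℚ + q) + (1ℚ + q)) * (x * (x + U) + F)
pairSum-bound-step q x U F q>0 hyp = *-cancelˡ-≤-pos q {{q>0}} (begin
  q * ((1ℚ + (1ℚ + q)) * ((x + U) * (x + U)))
    ≤⟨ 0≤q⇒p≤p+q _ (+-mono-≤ (0≤p*q 0≤1+q (p≤q⇒0≤q-p hyp)) (0≤p*p (q * x - U))) ⟩
  q * ((1ℚ + (1ℚ + q)) * ((x + U) * (x + U)))
    + ((1ℚ + q) * ((q + q) * F - (1ℚ + q) * (U * U)) + (q * x - U) * (q * x - U))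
    ≡⟨ identity q x U F ⟩
  q * (((1ℚ + q) + (1ℚ + q)) * (x * (x + U) + F)) ∎)
  where
  open ≤-Reasoning
  open Solver.+-*-Solver
  0≤1+q : 0ℚ ≤ℚ 1ℚ + q
  0≤1+q = +-mono-≤ (nonNegative⁻¹ 1ℚ) (<⇒≤ (positive⁻¹ q {{q>0}}))
  identity : ∀ q x U F →
    q * ((1ℚ + (1ℚ + q)) * ((x + U) * (x + U)))
      + ((1ℚ + q) * ((q + q) * F - (1ℚ + q) * (U * U)) + (q * x - U) * (q * x - U))
    ≡ q * (((1ℚ + q) + (1ℚ + q)) * (x * (x + U) + F))
  identity = solve 4 (λ q x U F →
    q :* ((con 1ℚ :+ (con 1ℚ :+ q)) :* ((x :+ U) :* (x :+ U)))
      :+ ((con 1ℚ :+ q) :* ((q :+ q) :* F :- (con 1ℚ :+ q) :* (U :* U)) :+ (q :* x :- U) :* (q :* x :- U))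
    := q :* (((con 1ℚ :+ q) :+ (con 1ℚ :+ q)) :* (x :* (x :+ U) :+ F))) refl

pairSum-bound : ∀ n p (u : Fin n → ℚ) → (∀ i → suc p ≤ toℕ i → u i ≡ 0ℚ) →
  fromℕ (suc (suc p)) * (Σ n u * Σ n u) ≤ℚ (fromℕ (suc p) + fromℕ (suc p)) * pairSum u
pairSum-bound zero    p       u _   =
  ≤-reflexive (trans (*-zeroʳ (fromℕ (suc (suc p)))) (sym (*-zeroʳ (fromℕ (suc p) + fromℕ (suc p)))))
pairSum-bound (suc n) zero    u u≡0 = ≤-reflexive (begin
  fromℕ 2 * ((x + U) * (x + U))       ≡⟨ cong (λ U → fromℕ 2 * ((x + U) * (x + U))) U≡0 ⟩
  fromℕ 2 * ((x + 0ℚ) * (x + 0ℚ))     ≡⟨ identity x ⟩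
  two * (x * (x + 0ℚ) + 0ℚ)           ≡⟨ cong₂ (λ U F → two * (x * (x + U) + F)) (sym U≡0) (sym F≡0) ⟩
  two * (x * (x + U) + pairSum u′)    ≡⟨ cong (two *_) (pairSum-suc u) ⟨
  two * pairSum u                     ∎)
  where
  open ≡-Reasoning
  two = fromℕ 1 + fromℕ 1
  x = u fz
  u′ = u ∘ fs
  U = Σ n u′
  u′≡0 : ∀ i → u′ i ≡ 0ℚ
  u′≡0 i = u≡0 (fs i) (s≤s z≤n)
  U≡0 : U ≡ 0ℚ
  U≡0 = Σ-0 n u′≡0
  F≡0 : pairSum u′ ≡ 0ℚ
  F≡0 = Σ-0 n (λ i → trans (cong (_* tailSum u′ i) (u′≡0 i)) (*-zeroˡ (tailSum u′ i)))
  identity : ∀ x → fromℕ 2 * ((x + 0ℚ) * (x + 0ℚ)) ≡ two * (x * (x + 0ℚ) + 0ℚ)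
  identity = solve 1 (λ x → (con 1ℚ :+ (con 1ℚ :+ con 0ℚ)) :* ((x :+ con 0ℚ) :* (x :+ con 0ℚ))
    := ((con 1ℚ :+ con 0ℚ) :+ (con 1ℚ :+ con 0ℚ)) :* (x :* (x :+ con 0ℚ) :+ con 0ℚ)) refl
    where open Solver.+-*-Solver
pairSum-bound (suc n) (suc p) u u≡0 = ≤-trans
  (pairSum-bound-step (fromℕ (suc p)) (u fz) (Σ n (u ∘ fs)) (pairSum (u ∘ fs)) (fromℕ-pos p)
    (pairSum-bound n p (u ∘ fs) (λ i p<i → u≡0 (fs i) (s≤s p<i))))
  (≤-reflexive (cong (λ F → (fromℕ (suc (suc p)) + fromℕ (suc (suc p))) * F) (sym (pairSum-suc u))))

above : ∀ {k} → ℕ → Fin k → Fin k → Bool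
above θ i j = toℕ i ℕ.+ θ ≤ᵇ toℕ j

above-≤-trans : ∀ {k} θ (i i′ j : Fin k) → T (toℕ i ≤ᵇ toℕ i′) → T (above θ i′ j) → T (above θ i j)
above-≤-trans θ i i′ j i≤i′ i′+θ≤j = ℕ.≤⇒≤ᵇ (ℕ.≤-trans
  (ℕ.+-monoˡ-≤ θ (ℕ.≤ᵇ⇒≤ (toℕ i) (toℕ i′) i≤i′)) (ℕ.≤ᵇ⇒≤ (toℕ i′ ℕ.+ θ) (toℕ j) i′+θ≤j))

-- ΣAbove k θ a unfolds to Σ k (rowSumAbove θ a).
rowSumAbove : ∀ {k} → ℕ → Matrix k → Fin k → ℚ
rowSumAbove {k} θ a i = Σ k (λ j → when (above θ i j) (a i j))

module _ {k : ℕ} (θ : ℕ) (a : Matrix k) (a≥0 : ∀ i j → 0ℚ ≤ℚ a i j) where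

  rowSumAbove-nonNeg : ∀ i → 0ℚ ≤ℚ rowSumAbove θ a i
  rowSumAbove-nonNeg i = Σ-nonNeg k (λ j → when-nonNeg (above θ i j) (a≥0 i j))

  rowSumAbove-≤-rowSum : ∀ i → rowSumAbove θ a i ≤ℚ rowSum a i
  rowSumAbove-≤-rowSum i = Σ-mono k (λ j → when-≤ (above θ i j) (a≥0 i j))

  tailSum-rowSumAbove-≤ : ∀ i → tailSum (rowSumAbove θ a) i ≤ℚ Σ k (λ j → when (above θ i j) (colSum a j))
  tailSum-rowSumAbove-≤ i = begin
    Σ k (λ i′ → when (toℕ i ≤ᵇ toℕ i′) (Σ k (λ j → when (above θ i′ j) (a i′ j))))
      ≡⟨ Σ-cong k (λ i′ → Σ-when k (toℕ i ≤ᵇ toℕ i′) (λ j → when (above θ i′ j) (a i′ j))) ⟨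
    Σ k (λ i′ → Σ k (λ j → when (toℕ i ≤ᵇ toℕ i′) (when (above θ i′ j) (a i′ j))))
      ≡⟨ Σ-comm k k _ ⟩
    Σ k (λ j → Σ k (λ i′ → when (toℕ i ≤ᵇ toℕ i′) (when (above θ i′ j) (a i′ j))))
      ≤⟨ Σ-mono k (λ j → Σ-mono k (λ i′ →
           when-when-≤ (toℕ i ≤ᵇ toℕ i′) (above θ i′ j) (above θ i j) (above-≤-trans θ i i′ j) (a≥0 i′ j))) ⟩
    Σ k (λ j → Σ k (λ i′ → when (above θ i j) (a i′ j)))
      ≡⟨ Σ-cong k (λ j → Σ-when k (above θ i j) (λ i′ → a i′ j)) ⟩
    Σ k (λ j → when (above θ i j) (colSum a j)) ∎
    where open ≤-Reasoning

  pairSum-rowSumAbove-≤ : pairSum (rowSumAbove θ a) ≤ℚ ΣAbove k θ (λ i j → rowSum a i * colSum a j)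
  pairSum-rowSumAbove-≤ = Σ-mono k (λ i → ≤-trans
    (*-mono-≤-nonNeg (≤-trans (rowSumAbove-nonNeg i) (rowSumAbove-≤-rowSum i))
      (Σ-nonNeg k (λ i′ → when-nonNeg (toℕ i ≤ᵇ toℕ i′) (rowSumAbove-nonNeg i′)))
      (rowSumAbove-≤-rowSum i) (tailSum-rowSumAbove-≤ i))
    (≤-reflexive (trans (*-distribˡ-Σ k (rowSum a i) _)
      (Σ-cong k (λ j → *-when (above θ i j) (rowSum a i) (colSum a j))))))

rowSumAbove-vanishes : ∀ {k} θ (a : Matrix k) i → k ∸ θ ≤ toℕ i → rowSumAbove θ a i ≡ 0ℚ
rowSumAbove-vanishes {k} θ a i k∸θ≤i = Σ-0 k (λ j → when-false (a i j) (λ i+θ≤j →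
  ℕ.<⇒≱ (ℕ.<-≤-trans (toℕ<n j) k≤i+θ) (ℕ.≤ᵇ⇒≤ (toℕ i ℕ.+ θ) (toℕ j) i+θ≤j)))
  where
  k≤i+θ : k ≤ toℕ i ℕ.+ θ
  k≤i+θ = ℕ.≤-trans (ℕ.m≤n+m∸n k θ)
    (subst (θ ℕ.+ (k ∸ θ) ≤_) (ℕ.+-comm θ (toℕ i)) (ℕ.+-monoʳ-≤ θ k∸θ≤i))

coef*2n≡1+n : ∀ k θ m → k ∸ θ ≡ suc m → coef k θ * (fromℕ (suc m) + fromℕ (suc m)) ≡ fromℕ (suc (suc m))
coef*2n≡1+n k θ m k∸θ≡1+m with k ∸ θ
coef*2n≡1+n k θ m refl | .(suc m) = begin
  c * (fromℕ n + fromℕ n)            ≡⟨ cong (λ d → c * (fromℕ n + fromℕ d)) (ℕ.+-identityʳ n) ⟨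
  c * (fromℕ n + fromℕ (n ℕ.+ 0))    ≡⟨ cong (c *_) (×-homo-+ 1ℚ n (n ℕ.+ 0)) ⟨
  c * fromℕ (2 ℕ.* n)                ≡⟨ n/d*d≡n (n ℕ.+ 1) (m ℕ.+ (n ℕ.+ 0)) ⟩
  fromℕ (n ℕ.+ 1)                    ≡⟨ cong fromℕ (ℕ.+-comm n 1) ⟩
  fromℕ (suc n)                      ∎
  where
  open ≡-Reasoning
  n = suc m
  c = + (n ℕ.+ 1) / (2 ℕ.* n)

lemma2 : (k θ : ℕ) → (a : Matrix k) → (∀ i j → 0ℚ ≤ℚ a i j) → 1 ≤ θ → θ ≤ k ∸ 1 →
    coef k θ * (ΣAbove k θ a * ΣAbove k θ a) ≤ℚ ΣAbove k θ (λ i j → rowSum a i * colSum a j)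
lemma2 zero    θ a a≥0 1≤θ θ≤0 = ⊥-elim (ℕ.≤⇒≯ θ≤0 1≤θ)
lemma2 (suc k) θ a a≥0 _ θ≤k = *-cancelˡ-≤-pos D {{D>0}} (begin
  D * (coef (suc k) θ * (S * S))  ≡⟨ *-assoc D (coef (suc k) θ) (S * S) ⟨
  (D * coef (suc k) θ) * (S * S)  ≡⟨ cong (_* (S * S)) (trans (*-comm D _) (coef*2n≡1+n (suc k) θ m 1+k∸θ≡1+m)) ⟩
  fromℕ (suc (suc m)) * (S * S)   ≤⟨ pairSum-bound (suc k) m u u-vanishes ⟩
  D * pairSum u                   ≤⟨ *-monoˡ-≤-nonNeg D {{pos⇒nonNeg D {{D>0}}}} (pairSum-rowSumAbove-≤ θ a a≥0) ⟩
  D * ΣAbove (suc k) θ (λ i j → rowSum a i * colSum a j) ∎)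
  where
  open ≤-Reasoning
  m = k ∸ θ
  1+k∸θ≡1+m : suc k ∸ θ ≡ suc m
  1+k∸θ≡1+m = ℕ.+-∸-assoc 1 θ≤k
  u = rowSumAbove θ a
  S = ΣAbove (suc k) θ a
  D = fromℕ (suc m) + fromℕ (suc m)
  D>0 : Positive D
  D>0 = pos+pos⇒pos (fromℕ (suc m)) {{fromℕ-pos m}} (fromℕ (suc m)) {{fromℕ-pos m}}
  u-vanishes : ∀ i → suc m ≤ toℕ i → u i ≡ 0ℚ
  u-vanishes i 1+m≤i = rowSumAbove-vanishes θ a i (subst (_≤ toℕ i) (sym 1+k∸θ≡1+m) 1+m≤i)
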